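{- Let $1\leq\beta\leq\ell$ be integers, $k\geq5$, and $a,b\in\{0,1\}^{\ell\times\ell}$, and let $G=G(\ell,\beta)$ be the directed graph described in the context. If $a$ and $b$ are disjoint, then $G$ has a directed $k$-spanner with at most $7\ell^2$ edges. If $a$ and $b$ are far from being disjoint, then every directed $k$-spanner of $G$ contains at least $\frac{\beta^2}{12}\ell^2$ edges of $D$.
   Context: The directed graph $G(\ell,\beta)$ has vertices $x^1_i,x^2_i,y^1_i,y^2_i,y^3_i$ for $1\leq i\leq\ell$ and $x_{ij},y_{ij}$ for $1\leq i\leq\ell$, $1\leq j\leq\beta$. Its directed edges are: $(x^1_i,y^1_i)$ and $(x^2_i,y^2_i)$ for all $i$; the set $D$ of all edges $(x_{ij},y_{rs})$ for all $1\leq i,r\leq\ell$, $1\leq j,s\leq\beta$; $(x_{ij},x^1_i)$ for all $i,j$; $(y^3_i,y_{ij})$ for all $i,j$; $(y^2_i,y^3_i)$ for all $i$; the edge $(x^1_i,x^2_j)$ if and only if $a_{ij}=0$; and the edge $(y^1_i,y^2_j)$ if and only if $b_{ij}=0$. The inputs $a,b$ are disjoint if there is no pair $(i,j)$ with $a_{ij}=b_{ij}=1$, and far from being disjoint if there are at least $\frac{\ell^2}{12}$ pairs $(i,j)$ with $a_{ij}=b_{ij}=1$. A directed $k$-spanner of $G$ is a subgraph $H$ such that every edge $(u,v)$ of $G$ has a directed path with at most $k$ edges from $u$ to $v$ in $H$. -}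

module Defs where

open import Data.Nat using (ℕ; zero; suc; _+_; _*_; _≤_)
open import Data.Fin using (Fin; zero; suc)
open import Data.Bool using (Bool; true; false; _∧_; if_then_else_)
open import Data.List using (List; []; _∷_; length)
open import Data.List.Relation.Unary.All using (All)
open import Data.List.Relation.Unary.Unique.Propositional using (Unique)
open import Data.List.Membership.Propositional using (_∈_)
open import Data.Product using (_×_; _,_; proj₁; proj₂)
open import Relation.Binary.PropositionalEquality using (_≡_)
open import Relation.Nullary using (¬_)

Matrix : ℕ → Set
Matrix ℓ = Fin ℓ → Fin ℓ → Bool

data V (ℓ β : ℕ) : Set where
  x¹ x² y¹ y² y³ : Fin ℓ → V ℓ β
  x y : Fin ℓ → Fin β → V ℓ β

data Edge {ℓ β : ℕ} (a b : Matrix ℓ) : V ℓ β → V ℓ β → Set where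
  e-x¹y¹ : ∀ i → Edge a b (x¹ i) (y¹ i)
  e-x²y² : ∀ i → Edge a b (x² i) (y² i)
  e-D    : ∀ i j r s → Edge a b (x i j) (y r s)
  e-xx¹  : ∀ i j → Edge a b (x i j) (x¹ i)
  e-y³y  : ∀ i j → Edge a b (y³ i) (y i j)
  e-y²y³ : ∀ i → Edge a b (y² i) (y³ i)
  e-a    : ∀ i j → a i j ≡ false → Edge a b (x¹ i) (x² j)
  e-b    : ∀ i j → b i j ≡ false → Edge a b (y¹ i) (y² j)

isD : ∀ {ℓ β} → V ℓ β → V ℓ β → Bool
isD (x _ _) (y _ _) = true
isD _ _ = false

countD : ∀ {ℓ β} → List (V ℓ β × V ℓ β) → ℕ
countD [] = 0
countD ((u , v) ∷ es) = (if isD u v then 1 else 0) + countD es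

data Reach {ℓ β : ℕ} (H : List (V ℓ β × V ℓ β)) : ℕ → V ℓ β → V ℓ β → Set where
  here : ∀ {k u} → Reach H k u u
  step : ∀ {k u w v} → (u , w) ∈ H → Reach H k w v → Reach H (suc k) u v

record Spanner (ℓ β : ℕ) (a b : Matrix ℓ) (k : ℕ) : Set where
  field
    edges    : List (V ℓ β × V ℓ β)
    unique   : Unique edges
    subgraph : All (λ e → Edge a b (proj₁ e) (proj₂ e)) edges
    spans    : ∀ u v → Edge a b u v → Reach edges k u v

size : ∀ {ℓ β a b k} → Spanner ℓ β a b k → ℕ
size H = length (Spanner.edges H)

sizeD : ∀ {ℓ β a b k} → Spanner ℓ β a b k → ℕ
sizeD H = countD (Spanner.edges H)

sumF : (n : ℕ) → (Fin n → ℕ) → ℕ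
sumF zero f = 0
sumF (suc n) f = f zero + sumF n (λ i → f (suc i))

common : ∀ {ℓ} → Matrix ℓ → Matrix ℓ → ℕ
common {ℓ} a b = sumF ℓ (λ i → sumF ℓ (λ j → if a i j ∧ b i j then 1 else 0))

Disjoint : ∀ {ℓ} → Matrix ℓ → Matrix ℓ → Set
Disjoint a b = ∀ i j → ¬ (a i j ≡ true × b i j ≡ true)

FarFromDisjoint : ∀ {ℓ} → Matrix ℓ → Matrix ℓ → Set
FarFromDisjoint {ℓ} a b = ℓ * ℓ ≤ 12 * common a b

-- If a and b are disjoint, the arc (x i j , y r s) of D is replaced by the 5-path
-- x i j → x¹ i → x² r → y² r → y³ r → y r s when a i r = 0, and by
-- x i j → x¹ i → y¹ i → y² r → y³ r → y r s when b i r = 0; the spanner then consists of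
-- seven families of at most ℓ² arcs each. Conversely, the y-vertices are sinks and from x¹ i
-- the vertex y r s is reachable only when a i r ∧ b i r = 0, so for each of the common pairs
-- (i , r) every one of the β² arcs (x i j , y r s) lies in every spanner.
module Submission where

open import Defs
open import Data.Bool using (Bool; true; false; T; T?; if_then_else_; _∧_; _≟_)
open import Data.Bool.Properties using (∧-zeroʳ)
open import Data.Empty using (⊥; ⊥-elim)
open import Data.Fin using (Fin; zero; suc)
import Data.Fin as Fin
open import Data.Fin.Patterns using (0F; 1F; 2F; 3F; 4F)
open import Data.List
  using (List; []; _∷_; _++_; length; map; concat; tabulate; allFin; filter; filterᵇ; cartesianProduct; deduplicate)
open import Data.List.Properties
  using (length-++; length-map; length-tabulate; length-filter; length-deduplicate; length-removeAt′; filter-++; map-tabulate)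
open import Data.List.Membership.Propositional using (_∈_)
open import Data.List.Membership.Propositional.Properties
  using (∈-map⁺; ∈-map⁻; ∈-tabulate⁺; ∈-filter⁺; ∈-filter⁻; ∈-cartesianProduct⁺; ∈-cartesianProduct⁻; ∈-concat⁺′; ∈-deduplicate⁺)
open import Data.List.Relation.Binary.Subset.Propositional using (_⊆_)
open import Data.List.Relation.Unary.All using (All; []; _∷_; lookup)
import Data.List.Relation.Unary.All as All
import Data.List.Relation.Unary.All.Properties as AllP
open import Data.List.Relation.Unary.AllPairs using (_∷_)
open import Data.List.Relation.Unary.Any using (here; there; _─_)
open import Data.List.Relation.Unary.Unique.Propositional using (Unique)
import Data.List.Relation.Unary.Unique.Propositional.Properties as Unique
open import Data.List.Relation.Unary.Unique.DecPropositional.Properties using (deduplicate-!)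
open import Data.Nat using (ℕ; zero; suc; _+_; _*_; _≤_; z≤n; s≤s)
open import Data.Nat.Properties using (≤-trans; +-mono-≤; *-monoʳ-≤; *-identityʳ; *-comm; *-assoc; module ≤-Reasoning)
open import Data.Product using (Σ; _×_; _,_; proj₂; uncurry)
open import Data.Product.Properties using () renaming (≡-dec to Σ-≡-dec)
open import Data.Sum using (_⊎_; inj₁; inj₂)
open import Data.Sum.Properties using () renaming (≡-dec to ⊎-≡-dec)
open import Function using (_∘_; id)
open import Relation.Binary.Definitions using (DecidableEquality)
open import Relation.Binary.PropositionalEquality
open import Relation.Nullary using (contradiction)
open import Relation.Nullary.Decidable using (map′)
open import Relation.Unary using (Decidable)

private variable
  A B : Set
  m n : ℕ

allPairs : (m n : ℕ) → List (Fin m × Fin n)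
allPairs m n = cartesianProduct (allFin m) (allFin n)

∈-allPairs : (i : Fin m) (j : Fin n) → (i , j) ∈ allPairs m n
∈-allPairs i j = ∈-cartesianProduct⁺ (∈-tabulate⁺ i) (∈-tabulate⁺ j)

length-cartesianProduct : (xs : List A) (ys : List B) →
                          length (cartesianProduct xs ys) ≡ length xs * length ys
length-cartesianProduct [] ys = refl
length-cartesianProduct (z ∷ zs) ys = begin
  length (map (z ,_) ys ++ cartesianProduct zs ys)         ≡⟨ length-++ (map (z ,_) ys) ⟩
  length (map (z ,_) ys) + length (cartesianProduct zs ys) ≡⟨ cong₂ _+_ (length-map (z ,_) ys) (length-cartesianProduct zs ys) ⟩
  length ys + length zs * length ys                        ∎
  where open ≡-Reasoning

length-allPairs : (m n : ℕ) → length (allPairs m n) ≡ m * n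
length-allPairs m n =
  trans (length-cartesianProduct (allFin m) (allFin n)) (cong₂ _*_ (length-tabulate {n = m} _) (length-tabulate {n = n} _))

sumF-cong : ∀ {f g : Fin n → ℕ} → (∀ i → f i ≡ g i) → sumF n f ≡ sumF n g
sumF-cong {zero} f≡g = refl
sumF-cong {suc n} f≡g = cong₂ _+_ (f≡g zero) (sumF-cong (f≡g ∘ suc))

length-filterᵇ-tabulate : (p : A → Bool) (f : Fin n → A) →
                          length (filterᵇ p (tabulate f)) ≡ sumF n (λ i → if p (f i) then 1 else 0)
length-filterᵇ-tabulate {n = zero} p f = refl
length-filterᵇ-tabulate {n = suc n} p f with p (f zero)
... | true = cong suc (length-filterᵇ-tabulate p (f ∘ suc))
... | false = length-filterᵇ-tabulate p (f ∘ suc)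

length-filterᵇ-cartesianProduct : (p : A × B → Bool) (f : Fin m → A) (ys : List B) →
  length (filterᵇ p (cartesianProduct (tabulate f) ys)) ≡ sumF m (λ i → length (filterᵇ p (map (f i ,_) ys)))
length-filterᵇ-cartesianProduct {m = zero} p f ys = refl
length-filterᵇ-cartesianProduct {m = suc m} p f ys = begin
  length (filterᵇ p (row ++ rest))                  ≡⟨ cong length (filter-++ (T? ∘ p) row rest) ⟩
  length (filterᵇ p row ++ filterᵇ p rest)          ≡⟨ length-++ (filterᵇ p row) ⟩
  length (filterᵇ p row) + length (filterᵇ p rest)  ≡⟨ cong (length (filterᵇ p row) +_) (length-filterᵇ-cartesianProduct p (f ∘ suc) ys) ⟩
  length (filterᵇ p row) + sumF m (λ i → length (filterᵇ p (map (f (suc i) ,_) ys))) ∎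
  where
  open ≡-Reasoning
  row  = map (f zero ,_) ys
  rest = cartesianProduct (tabulate (f ∘ suc)) ys

length-filterᵇ-allPairs : (p : Fin m × Fin n → Bool) →
  length (filterᵇ p (allPairs m n)) ≡ sumF m (λ i → sumF n (λ j → if p (i , j) then 1 else 0))
length-filterᵇ-allPairs {m} {n} p = begin
  length (filterᵇ p (allPairs m n))                         ≡⟨ length-filterᵇ-cartesianProduct p id (allFin n) ⟩
  sumF m (λ i → length (filterᵇ p (map (i ,_) (allFin n)))) ≡⟨ sumF-cong (λ i → cong (length ∘ filterᵇ p) (map-tabulate id (i ,_))) ⟩
  sumF m (λ i → length (filterᵇ p (tabulate (i ,_))))       ≡⟨ sumF-cong (λ i → length-filterᵇ-tabulate p (i ,_)) ⟩
  sumF m (λ i → sumF n (λ j → if p (i , j) then 1 else 0))  ∎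
  where open ≡-Reasoning

∈-─ : ∀ {u v : A} {ys} (u∈ys : u ∈ ys) → v ∈ ys → v ≢ u → v ∈ (ys ─ u∈ys)
∈-─ (here refl) (here refl) v≢u = contradiction refl v≢u
∈-─ (here refl) (there v∈ys) v≢u = v∈ys
∈-─ (there u∈ys) (here refl) v≢u = here refl
∈-─ (there u∈ys) (there v∈ys) v≢u = there (∈-─ u∈ys v∈ys v≢u)

unique-⊆⇒length-≤ : ∀ {xs ys : List A} → Unique xs → xs ⊆ ys → length xs ≤ length ys
unique-⊆⇒length-≤ {xs = []} _ _ = z≤n
unique-⊆⇒length-≤ {xs = u ∷ xs} {ys} (u∉xs ∷ !xs) xs⊆ys =
  subst (suc (length xs) ≤_) (sym (length-removeAt′ ys _))
    (s≤s (unique-⊆⇒length-≤ !xs (λ v∈xs → ∈-─ u∈ys (xs⊆ys (there v∈xs)) (λ { refl → lookup u∉xs v∈xs refl }))))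
  where u∈ys = xs⊆ys (here refl)

length-concat-≤ : ∀ {c} (xss : List (List A)) → All (λ xs → length xs ≤ c) xss → length (concat xss) ≤ length xss * c
length-concat-≤ [] [] = z≤n
length-concat-≤ (xs ∷ xss) (xs≤c ∷ xss≤c) = subst (_≤ _) (sym (length-++ xs)) (+-mono-≤ xs≤c (length-concat-≤ xss xss≤c))

Reach-mono : ∀ {ℓ β} {H : List (V ℓ β × V ℓ β)} {k k′ u v} → k ≤ k′ → Reach H k u v → Reach H k′ u v
Reach-mono _ here = here
Reach-mono (s≤s k≤k′) (step e∈H walk) = step e∈H (Reach-mono k≤k′ walk)

module _ {ℓ β : ℕ} where

  VertexCode : Set
  VertexCode = (Fin 5 × Fin ℓ) ⊎ (Fin 2 × Fin ℓ × Fin β)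

  encode : V ℓ β → VertexCode
  encode (x¹ i) = inj₁ (0F , i)
  encode (x² i) = inj₁ (1F , i)
  encode (y¹ i) = inj₁ (2F , i)
  encode (y² i) = inj₁ (3F , i)
  encode (y³ i) = inj₁ (4F , i)
  encode (x i j) = inj₂ (0F , i , j)
  encode (y i j) = inj₂ (1F , i , j)

  decode : VertexCode → V ℓ β
  decode (inj₁ (0F , i)) = x¹ i
  decode (inj₁ (1F , i)) = x² i
  decode (inj₁ (2F , i)) = y¹ i
  decode (inj₁ (3F , i)) = y² i
  decode (inj₁ (4F , i)) = y³ i
  decode (inj₂ (0F , i , j)) = x i j
  decode (inj₂ (1F , i , j)) = y i j

  decode-encode : ∀ v → decode (encode v) ≡ v
  decode-encode (x¹ _) = refl
  decode-encode (x² _) = refl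
  decode-encode (y¹ _) = refl
  decode-encode (y² _) = refl
  decode-encode (y³ _) = refl
  decode-encode (x _ _) = refl
  decode-encode (y _ _) = refl

  _≟V_ : DecidableEquality (V ℓ β)
  u ≟V v = map′ encode-injective (cong encode) (encode u ≟C encode v)
    where
    _≟C_ : DecidableEquality VertexCode
    _≟C_ = ⊎-≡-dec (Σ-≡-dec Fin._≟_ Fin._≟_) (Σ-≡-dec Fin._≟_ (Σ-≡-dec Fin._≟_ Fin._≟_))
    encode-injective : encode u ≡ encode v → u ≡ v
    encode-injective eq = trans (sym (decode-encode u)) (trans (cong decode eq) (decode-encode v))

module _ {ℓ β : ℕ} (a b : Matrix ℓ) where

  Arc : Set
  Arc = V ℓ β × V ℓ β

  IsSubgraph : List Arc → Set
  IsSubgraph H = All (uncurry (Edge a b)) H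

  Reach-closed : ∀ {H k u v} (P : V ℓ β → Set) → (∀ {u w} → Edge a b u w → P u → P w) →
                 IsSubgraph H → Reach H k u v → P u → P v
  Reach-closed P closed H⊆G here Pu = Pu
  Reach-closed P closed H⊆G (step e∈H walk) Pu = Reach-closed P closed H⊆G walk (closed (lookup H⊆G e∈H) Pu)

  Reachable-x¹ : Fin ℓ → V ℓ β → Set
  Reachable-x¹ i (x¹ i′) = i′ ≡ i
  Reachable-x¹ i (y¹ i′) = i′ ≡ i
  Reachable-x¹ i (x² j) = a i j ≡ false
  Reachable-x¹ i (y² j) = a i j ∧ b i j ≡ false
  Reachable-x¹ i (y³ j) = a i j ∧ b i j ≡ false
  Reachable-x¹ i (y j _) = a i j ∧ b i j ≡ false
  Reachable-x¹ i (x _ _) = ⊥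

  Reachable-x¹-closed : ∀ {i u w} → Edge a b u w → Reachable-x¹ i u → Reachable-x¹ i w
  Reachable-x¹-closed (e-x¹y¹ _) refl = refl
  Reachable-x¹-closed {i} (e-x²y² j) aᵢⱼ≡0 = cong (_∧ b i j) aᵢⱼ≡0
  Reachable-x¹-closed (e-y²y³ _) ab≡0 = ab≡0
  Reachable-x¹-closed (e-y³y _ _) ab≡0 = ab≡0
  Reachable-x¹-closed (e-a _ _ aᵢⱼ≡0) refl = aᵢⱼ≡0
  Reachable-x¹-closed {i} (e-b _ j bᵢⱼ≡0) refl = trans (cong (a i j ∧_) bᵢⱼ≡0) (∧-zeroʳ (a i j))

  forced-arc : ∀ {H k i j r s} → IsSubgraph H → Reach H k (x i j) (y r s) → T (a i r ∧ b i r) →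
               (x i j , y r s) ∈ H
  forced-arc H⊆G (step e∈H walk) abᵢᵣ with lookup H⊆G e∈H
  forced-arc H⊆G (step e∈H here) abᵢᵣ | e-D _ _ _ _ = e∈H
  forced-arc H⊆G (step e∈H (step e′∈H _)) abᵢᵣ | e-D _ _ _ _ with lookup H⊆G e′∈H
  ... | ()
  forced-arc H⊆G (step e∈H walk) abᵢᵣ | e-xx¹ _ _ =
    ⊥-elim (subst T (Reach-closed (Reachable-x¹ _) Reachable-x¹-closed H⊆G walk refl) abᵢᵣ)

  bothᵇ : Fin ℓ × Fin ℓ → Bool
  bothᵇ (i , r) = a i r ∧ b i r

  commonPairs : List (Fin ℓ × Fin ℓ)
  commonPairs = filterᵇ bothᵇ (allPairs ℓ ℓ)

  forcedArc : (Fin ℓ × Fin ℓ) × (Fin β × Fin β) → Arc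
  forcedArc ((i , r) , (j , s)) = x i j , y r s

  forcedArcs : List Arc
  forcedArcs = map forcedArc (cartesianProduct commonPairs (allPairs β β))

  length-forcedArcs : length forcedArcs ≡ common a b * (β * β)
  length-forcedArcs = begin
    length forcedArcs                                           ≡⟨ length-map forcedArc (cartesianProduct commonPairs (allPairs β β)) ⟩
    length (cartesianProduct commonPairs (allPairs β β))        ≡⟨ length-cartesianProduct commonPairs (allPairs β β) ⟩
    length commonPairs * length (allPairs β β)                  ≡⟨ cong₂ _*_ (length-filterᵇ-allPairs bothᵇ) (length-allPairs β β) ⟩
    common a b * (β * β)                                        ∎
    where open ≡-Reasoning

  forcedArcs-unique : Unique forcedArcs
  forcedArcs-unique = Unique.map⁺ forcedArc-injective
    (Unique.cartesianProduct⁺ (Unique.filter⁺ _ allPairs-unique) allPairs-unique)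
    where
    forcedArc-injective : ∀ {p q} → forcedArc p ≡ forcedArc q → p ≡ q
    forcedArc-injective {(_ , _) , (_ , _)} {(_ , _) , (_ , _)} refl = refl
    allPairs-unique : ∀ {m n} → Unique (allPairs m n)
    allPairs-unique {m} {n} = Unique.cartesianProduct⁺ (Unique.allFin⁺ m) (Unique.allFin⁺ n)

  isDᵇ : Arc → Bool
  isDᵇ = uncurry isD

  countD-filter : ∀ H → countD H ≡ length (filterᵇ isDᵇ H)
  countD-filter [] = refl
  countD-filter ((u , v) ∷ H) with isD u v
  ... | true = cong suc (countD-filter H)
  ... | false = countD-filter H

  forcedArcs⊆D : ∀ {k} (H : Spanner ℓ β a b k) → forcedArcs ⊆ filterᵇ isDᵇ (Spanner.edges H)
  forcedArcs⊆D H e∈forced with ∈-map⁻ forcedArc e∈forced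
  ... | ((i , r) , (j , s)) , p∈ , refl with ∈-cartesianProduct⁻ commonPairs (allPairs β β) p∈
  ... | ir∈common , _ = ∈-filter⁺ (T? ∘ isDᵇ) (forced-arc (Spanner.subgraph H) (Spanner.spans H _ _ (e-D i j r s)) abᵢᵣ) _
    where abᵢᵣ = proj₂ (∈-filter⁻ (T? ∘ bothᵇ) {xs = allPairs ℓ ℓ} ir∈common)

  common*β²≤sizeD : ∀ {k} (H : Spanner ℓ β a b k) → common a b * (β * β) ≤ sizeD H
  common*β²≤sizeD H = begin
    common a b * (β * β)                     ≡⟨ length-forcedArcs ⟨
    length forcedArcs                        ≤⟨ unique-⊆⇒length-≤ forcedArcs-unique (forcedArcs⊆D H) ⟩
    length (filterᵇ isDᵇ (Spanner.edges H))  ≡⟨ countD-filter (Spanner.edges H) ⟨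
    sizeD H                                  ∎
    where open ≤-Reasoning

  far⇒β²ℓ²≤12*sizeD : ∀ {k} → FarFromDisjoint a b → (H : Spanner ℓ β a b k) → (β * β) * (ℓ * ℓ) ≤ 12 * sizeD H
  far⇒β²ℓ²≤12*sizeD far H = begin
    (β * β) * (ℓ * ℓ)           ≤⟨ *-monoʳ-≤ (β * β) far ⟩
    (β * β) * (12 * common a b) ≡⟨ *-comm (β * β) (12 * common a b) ⟩
    12 * common a b * (β * β)   ≡⟨ *-assoc 12 (common a b) (β * β) ⟩
    12 * (common a b * (β * β)) ≤⟨ *-monoʳ-≤ 12 (common*β²≤sizeD H) ⟩
    12 * sizeD H                ∎
    where open ≤-Reasoning

  sparseArcs : List (List Arc)
  sparseArcs =
      tabulate (λ i → x¹ i , y¹ i)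
    ∷ tabulate (λ i → x² i , y² i)
    ∷ tabulate (λ i → y² i , y³ i)
    ∷ map (λ (i , j) → x i j , x¹ i) (allPairs ℓ β)
    ∷ map (λ (i , j) → y³ i , y i j) (allPairs ℓ β)
    ∷ map (λ (i , j) → x¹ i , x² j) (filter (λ (i , j) → a i j ≟ false) (allPairs ℓ ℓ))
    ∷ map (λ (i , j) → y¹ i , y² j) (filter (λ (i , j) → b i j ≟ false) (allPairs ℓ ℓ))
    ∷ []

  sparseArcs-⊆G : All IsSubgraph sparseArcs
  sparseArcs-⊆G =
      AllP.tabulate⁺ e-x¹y¹
    ∷ AllP.tabulate⁺ e-x²y²
    ∷ AllP.tabulate⁺ e-y²y³
    ∷ AllP.map⁺ (All.universal (λ (i , j) → e-xx¹ i j) (allPairs ℓ β))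
    ∷ AllP.map⁺ (All.universal (λ (i , j) → e-y³y i j) (allPairs ℓ β))
    ∷ AllP.map⁺ (All.map (λ {(i , j)} → e-a i j) (AllP.all-filter _ (allPairs ℓ ℓ)))
    ∷ AllP.map⁺ (All.map (λ {(i , j)} → e-b i j) (AllP.all-filter _ (allPairs ℓ ℓ)))
    ∷ []

  sparseArcs-length : 1 ≤ ℓ → β ≤ ℓ → All (λ E → length E ≤ ℓ * ℓ) sparseArcs
  sparseArcs-length 1≤ℓ β≤ℓ =
    ℓ≤ℓ² _ ∷ ℓ≤ℓ² _ ∷ ℓ≤ℓ² _ ∷ ℓβ≤ℓ² _ ∷ ℓβ≤ℓ² _ ∷ filtered≤ℓ² _ _ ∷ filtered≤ℓ² _ _ ∷ []
    where
    open ≤-Reasoning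
    ℓ≤ℓ² : (f : Fin ℓ → Arc) → length (tabulate f) ≤ ℓ * ℓ
    ℓ≤ℓ² f = begin
      length (tabulate f) ≡⟨ length-tabulate f ⟩
      ℓ                   ≡⟨ *-identityʳ ℓ ⟨
      ℓ * 1               ≤⟨ *-monoʳ-≤ ℓ 1≤ℓ ⟩
      ℓ * ℓ               ∎
    ℓβ≤ℓ² : (f : Fin ℓ × Fin β → Arc) → length (map f (allPairs ℓ β)) ≤ ℓ * ℓ
    ℓβ≤ℓ² f = begin
      length (map f (allPairs ℓ β)) ≡⟨ length-map f (allPairs ℓ β) ⟩
      length (allPairs ℓ β)         ≡⟨ length-allPairs ℓ β ⟩
      ℓ * β                         ≤⟨ *-monoʳ-≤ ℓ β≤ℓ ⟩
      ℓ * ℓ                         ∎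
    filtered≤ℓ² : {P : Fin ℓ × Fin ℓ → Set} (P? : Decidable P) (f : Fin ℓ × Fin ℓ → Arc) →
                  length (map f (filter P? (allPairs ℓ ℓ))) ≤ ℓ * ℓ
    filtered≤ℓ² P? f = begin
      length (map f (filter P? (allPairs ℓ ℓ))) ≡⟨ length-map f (filter P? (allPairs ℓ ℓ)) ⟩
      length (filter P? (allPairs ℓ ℓ))         ≤⟨ length-filter P? (allPairs ℓ ℓ) ⟩
      length (allPairs ℓ ℓ)                     ≡⟨ length-allPairs ℓ ℓ ⟩
      ℓ * ℓ                                     ∎

  _≟Arc_ : DecidableEquality Arc
  _≟Arc_ = Σ-≡-dec _≟V_ _≟V_

  sparseEdges : List Arc
  sparseEdges = deduplicate _≟Arc_ (concat sparseArcs)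

  sparse∈ : ∀ {e E} → e ∈ E → E ∈ sparseArcs → e ∈ sparseEdges
  sparse∈ e∈E E∈ = ∈-deduplicate⁺ _≟Arc_ (∈-concat⁺′ e∈E E∈)

  x¹y¹∈ : ∀ i → (x¹ i , y¹ i) ∈ sparseEdges
  x¹y¹∈ i = sparse∈ (∈-tabulate⁺ i) (here refl)

  x²y²∈ : ∀ i → (x² i , y² i) ∈ sparseEdges
  x²y²∈ i = sparse∈ (∈-tabulate⁺ i) (there (here refl))

  y²y³∈ : ∀ i → (y² i , y³ i) ∈ sparseEdges
  y²y³∈ i = sparse∈ (∈-tabulate⁺ i) (there (there (here refl)))

  xx¹∈ : ∀ i j → (x i j , x¹ i) ∈ sparseEdges
  xx¹∈ i j = sparse∈ (∈-map⁺ _ (∈-allPairs i j)) (there (there (there (here refl))))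

  y³y∈ : ∀ i j → (y³ i , y i j) ∈ sparseEdges
  y³y∈ i j = sparse∈ (∈-map⁺ _ (∈-allPairs i j)) (there (there (there (there (here refl)))))

  x¹x²∈ : ∀ i j → a i j ≡ false → (x¹ i , x² j) ∈ sparseEdges
  x¹x²∈ i j aᵢⱼ≡0 = sparse∈ (∈-map⁺ _ (∈-filter⁺ _ (∈-allPairs i j) aᵢⱼ≡0))
    (there (there (there (there (there (here refl))))))

  y¹y²∈ : ∀ i j → b i j ≡ false → (y¹ i , y² j) ∈ sparseEdges
  y¹y²∈ i j bᵢⱼ≡0 = sparse∈ (∈-map⁺ _ (∈-filter⁺ _ (∈-allPairs i j) bᵢⱼ≡0))
    (there (there (there (there (there (there (here refl)))))))

  arc : ∀ {k u v} → (u , v) ∈ sparseEdges → Reach sparseEdges (suc k) u v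
  arc uv∈ = step uv∈ here

  sparse-spans : Disjoint a b → ∀ u v → Edge a b u v → Reach sparseEdges 5 u v
  sparse-spans _ _ _ (e-x¹y¹ i) = arc (x¹y¹∈ i)
  sparse-spans _ _ _ (e-x²y² i) = arc (x²y²∈ i)
  sparse-spans _ _ _ (e-y²y³ i) = arc (y²y³∈ i)
  sparse-spans _ _ _ (e-xx¹ i j) = arc (xx¹∈ i j)
  sparse-spans _ _ _ (e-y³y i j) = arc (y³y∈ i j)
  sparse-spans _ _ _ (e-a i j aᵢⱼ≡0) = arc (x¹x²∈ i j aᵢⱼ≡0)
  sparse-spans _ _ _ (e-b i j bᵢⱼ≡0) = arc (y¹y²∈ i j bᵢⱼ≡0)
  sparse-spans disjoint _ _ (e-D i j r s) with a i r in aᵢᵣ | b i r in bᵢᵣ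
  ... | false | _ =
    step (xx¹∈ i j) (step (x¹x²∈ i r aᵢᵣ) (step (x²y²∈ r) (step (y²y³∈ r) (arc (y³y∈ r s)))))
  ... | true | false =
    step (xx¹∈ i j) (step (x¹y¹∈ i) (step (y¹y²∈ i r bᵢᵣ) (step (y²y³∈ r) (arc (y³y∈ r s)))))
  ... | true | true = ⊥-elim (disjoint i r (aᵢᵣ , bᵢᵣ))

  sparseSpanner : ∀ {k} → Disjoint a b → 5 ≤ k → Spanner ℓ β a b k
  sparseSpanner disjoint 5≤k = record
    { edges    = sparseEdges
    ; unique   = deduplicate-! _≟Arc_ (concat sparseArcs)
    ; subgraph = AllP.deduplicate⁺ _≟Arc_ (AllP.concat⁺ sparseArcs-⊆G)
    ; spans    = λ u v uv → Reach-mono 5≤k (sparse-spans disjoint u v uv)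
    }

  sparseSpanner-size : ∀ {k} (disjoint : Disjoint a b) (5≤k : 5 ≤ k) → 1 ≤ ℓ → β ≤ ℓ →
                       size (sparseSpanner disjoint 5≤k) ≤ 7 * (ℓ * ℓ)
  sparseSpanner-size _ _ 1≤ℓ β≤ℓ = begin
    length sparseEdges          ≤⟨ length-deduplicate _≟Arc_ (concat sparseArcs) ⟩
    length (concat sparseArcs)  ≤⟨ length-concat-≤ sparseArcs (sparseArcs-length 1≤ℓ β≤ℓ) ⟩
    7 * (ℓ * ℓ)                 ∎
    where open ≤-Reasoning

lemma9 : (ℓ β k : ℕ) → 1 ≤ β → β ≤ ℓ → 5 ≤ k → (a b : Matrix ℓ) →
    (Disjoint a b → Σ (Spanner ℓ β a b k) (λ H → size H ≤ 7 * (ℓ * ℓ)))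
    × (FarFromDisjoint a b → (H : Spanner ℓ β a b k) → (β * β) * (ℓ * ℓ) ≤ 12 * sizeD H)
lemma9 ℓ β k 1≤β β≤ℓ 5≤k a b =
  (λ disjoint → sparseSpanner a b disjoint 5≤k , sparseSpanner-size a b disjoint 5≤k (≤-trans 1≤β β≤ℓ) β≤ℓ) ,
  far⇒β²ℓ²≤12*sizeD a b
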